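{- Let $G$ be a graph of order $n\geq 2$ and maximum degree $\Delta\ge 0$. For every $t\geq 2$, $$2^{t-1}\max(n+2,\,2(\Delta+2))-2\leq \lambda(M^t(G))\leq (2^t-1)(n+1)+\lambda(G).$$
   Context: Graphs are finite, simple, undirected. An $L(2,1)$-labeling of $G$ is a map $f:V\to\{0,1,2,\dots\}$ with $|f(x)-f(y)|\ge 2$ if $d_G(x,y)=1$ and $|f(x)-f(y)|\ge1$ if $d_G(x,y)=2$; $\lambda(G)$ is the minimum over such $f$ of the largest label. For $V=\{v_1,\dots,v_n\}$, the Mycielski graph $M(G)$ has vertex set $V\cup\{v_1',\dots,v_n'\}\cup\{u\}$ and edge set $E\cup\{v_iv_j' : v_iv_j\in E\}\cup\{v_i'u: 1\le i\le n\}$. The iterated Mycielski graphs are $M^0(G)=G$ and $M^t(G)=M(M^{t-1}(G))$ for $t\ge 1$. -}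

module Defs where

open import Data.Nat using (ℕ; zero; suc; _+_; _*_; _≤_; _⊔_; ∣_-_∣)
open import Data.Bool using (Bool; true; false)
open import Data.Fin using (Fin; splitAt) renaming (zero to fzero; suc to fsuc)
open import Data.List using (List; foldr; map; filter; length; allFin)
open import Data.Sum using (_⊎_; inj₁; inj₂)
open import Data.Product using (Σ; _×_; _,_)
open import Relation.Binary.PropositionalEquality using (_≡_; _≢_; refl)
open import Data.Bool.Properties using (T?)

record Graph : Set where
  field
    order  : ℕ
    adj    : Fin order → Fin order → Bool
    sym    : ∀ i j → adj i j ≡ adj j i
    irrefl : ∀ i → adj i i ≡ false
open Graph public

degree : (G : Graph) → Fin (order G) → ℕ
degree G v = length (filter (λ w → T? (adj G v w)) (allFin (order G)))

maxDegree : Graph → ℕ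
maxDegree G = foldr _⊔_ 0 (map (degree G) (allFin (order G)))

Adjacent : (G : Graph) → Fin (order G) → Fin (order G) → Set
Adjacent G x y = adj G x y ≡ true

Dist2 : (G : Graph) → Fin (order G) → Fin (order G) → Set
Dist2 G x y = x ≢ y × adj G x y ≡ false
              × Σ (Fin (order G)) (λ w → Adjacent G x w × Adjacent G w y)

IsL21 : (G : Graph) → (Fin (order G) → ℕ) → Set
IsL21 G f = (∀ x y → Adjacent G x y → 2 ≤ ∣ f x - f y ∣)
          × (∀ x y → Dist2 G x y → f x ≢ f y)

IsLambda : Graph → ℕ → Set
IsLambda G k =
  Σ (Fin (order G) → ℕ) (λ f → IsL21 G f × (∀ v → f v ≤ k))
  × (∀ (f : Fin (order G) → ℕ) (m : ℕ) → IsL21 G f → (∀ v → f v ≤ m) → k ≤ m)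

-- Mycielski graph. Vertices of M(G) are Fin (suc (n + n)):
-- fzero is u, fsuc (i ↑ˡ n) is v_i, fsuc (n ↑ʳ i) is v_i'.
data Kind (n : ℕ) : Set where
  orig copy : Fin n → Kind n
  apex : Kind n

cls : ∀ {n} → Fin (suc (n + n)) → Kind n
cls fzero = apex
cls {n} (fsuc i) with splitAt n i
... | inj₁ a = orig a
... | inj₂ b = copy b

adjK : (G : Graph) → Kind (order G) → Kind (order G) → Bool
adjK G (orig a) (orig b) = adj G a b
adjK G (orig a) (copy b) = adj G a b
adjK G (copy a) (orig b) = adj G a b
adjK G (copy a) (copy b) = false
adjK G (copy a) apex = true
adjK G apex (copy b) = true
adjK G (orig a) apex = false
adjK G apex (orig b) = false
adjK G apex apex = false

adjK-sym : (G : Graph) → ∀ k l → adjK G k l ≡ adjK G l k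
adjK-sym G (orig a) (orig b) = sym G a b
adjK-sym G (orig a) (copy b) = sym G a b
adjK-sym G (copy a) (orig b) = sym G a b
adjK-sym G (copy a) (copy b) = refl
adjK-sym G (copy a) apex = refl
adjK-sym G apex (copy b) = refl
adjK-sym G (orig a) apex = refl
adjK-sym G apex (orig b) = refl
adjK-sym G apex apex = refl

adjK-irrefl : (G : Graph) → ∀ k → adjK G k k ≡ false
adjK-irrefl G (orig a) = irrefl G a
adjK-irrefl G (copy a) = refl
adjK-irrefl G apex = refl

M : Graph → Graph
M G = record
  { order = suc (order G + order G)
  ; adj = λ x y → adjK G (cls x) (cls y)
  ; sym = λ x y → adjK-sym G (cls x) (cls y)
  ; irrefl = λ x → adjK-irrefl G (cls x)
  }

M^ : ℕ → Graph → Graph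
M^ zero G = G
M^ (suc t) G = M (M^ t G)

{-# OPTIONS --safe #-}
-- A set of non-isolated vertices at pairwise distance at most two needs pairwise distinct labels,
-- and such a set S in H gives the set S ∪ S′ ∪ {u} of size 2|S| + 1 in M H; after r steps a set
-- of size k has grown to size 2^r (k + 1) − 1. Starting from u with all copies in M G (k = n + 1),
-- or from a vertex of maximum degree with its neighbours in G (k = Δ + 1), gives the two terms of
-- the lower bound.
--
-- For the upper bound, a labelling of H with largest label K extends to M H by giving the copies
-- the fresh labels K + 2, …, K + 1 + |H| and the apex a label unused on H. The extension again
-- has such a spare label (K + 1) below its largest label, which is attained; at the last step
-- the copy of a vertex with the largest label can therefore take K + 1 instead. Altogether
-- λ(M^t G) + n ≤ λ(G) + |M^t G|, and |M^t G| + 1 = 2^t (n + 1).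
module Submission where

open import Defs hiding (sym)
open import Data.Nat using (ℕ; zero; suc; _+_; _*_; _∸_; _^_; _≤_; _<_; _⊔_; z≤n; s≤s; ∣_-_∣)
open import Data.Nat.Properties
open import Data.Nat.Tactic.RingSolver using (solve-∀)
open import Data.Fin using (Fin; toℕ; fromℕ; fromℕ<; _↑ˡ_; _↑ʳ_; splitAt) renaming (zero to fzero; suc to fsuc)
import Data.Fin.Properties as Finₚ
open import Data.Fin.Permutation using (Permutation′; transpose; _⟨$⟩ʳ_; _⟨$⟩ˡ_; inverseˡ)
open import Data.Product using (Σ-syntax; _×_; _,_; proj₁; proj₂)
open import Data.Sum using (_⊎_; inj₁; inj₂)
open import Data.Bool using (true; false)
open import Data.Bool.Properties using (T?; T-≡)
open import Data.Empty using (⊥-elim)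
open import Data.List using (List; _∷_; foldr; map; filter; allFin; lookup)
open import Data.List.Relation.Unary.Unique.Propositional using (Unique)
open import Data.List.Relation.Unary.AllPairs using (_∷_)
import Data.List.Relation.Unary.All as All
import Data.List.Relation.Unary.Unique.Propositional.Properties as Uniqueₚ
open import Data.List.Membership.Propositional.Properties using (∈-lookup; ∈-filter⁻)
open import Function using (_∘_)
open import Function.Bundles using (Equivalence)
open import Relation.Nullary using (yes; no)
open import Relation.Nullary.Decidable using (dec-true)
open import Relation.Binary.PropositionalEquality

private
  variable
    k l m n : ℕ

toVertex : Kind n → Fin (suc (n + n))
toVertex apex = fzero
toVertex {n} (orig a) = fsuc (a ↑ˡ n)
toVertex {n} (copy b) = fsuc (n ↑ʳ b)

cls-toVertex : (κ : Kind n) → cls (toVertex κ) ≡ κ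
cls-toVertex apex = refl
cls-toVertex {n} (orig a) rewrite Finₚ.splitAt-↑ˡ n a n = refl
cls-toVertex {n} (copy b) rewrite Finₚ.splitAt-↑ʳ n n b = refl

toVertex-cls : (x : Fin (suc (n + n))) → toVertex (cls {n} x) ≡ x
toVertex-cls fzero = refl
toVertex-cls {n} (fsuc i) with splitAt n i in eq
... | inj₁ a = cong fsuc (Finₚ.splitAt⁻¹-↑ˡ eq)
... | inj₂ b = cong fsuc (Finₚ.splitAt⁻¹-↑ʳ eq)

cls-injective : {x y : Fin (suc (n + n))} → cls {n} x ≡ cls y → x ≡ y
cls-injective {n} {x} {y} eq = trans (sym (toVertex-cls x)) (trans (cong toVertex eq) (toVertex-cls y))

toVertex-injective : {κ ν : Kind n} → toVertex κ ≡ toVertex ν → κ ≡ ν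
toVertex-injective {κ = κ} {ν} eq = trans (sym (cls-toVertex κ)) (trans (cong cls eq) (cls-toVertex ν))

orig-injective : {a b : Fin n} → orig a ≡ orig b → a ≡ b
orig-injective refl = refl

copy-injective : {a b : Fin n} → copy a ≡ copy b → a ≡ b
copy-injective refl = refl

-- Extending L(2,1)-labellings to M H

mycielskiLabel : (Fin n → ℕ) → (Fin n → ℕ) → ℕ → Kind n → ℕ
mycielskiLabel f h c (orig a) = f a
mycielskiLabel f h c (copy a) = h a
mycielskiLabel f h c apex = c

mycielskiLabel-≤ : {f h : Fin n → ℕ} {c : ℕ} →
  (∀ a → f a ≤ m) → (∀ a → h a ≤ m) → c ≤ m → ∀ κ → mycielskiLabel f h c κ ≤ m
mycielskiLabel-≤ f≤ h≤ c≤ (orig a) = f≤ a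
mycielskiLabel-≤ f≤ h≤ c≤ (copy a) = h≤ a
mycielskiLabel-≤ f≤ h≤ c≤ apex = c≤

mycielskiLabel-≢ : {f h : Fin n → ℕ} {c : ℕ} →
  (∀ a → f a ≢ m) → (∀ a → h a ≢ m) → c ≢ m → ∀ κ → mycielskiLabel f h c κ ≢ m
mycielskiLabel-≢ f≢ h≢ c≢ (orig a) = f≢ a
mycielskiLabel-≢ f≢ h≢ c≢ (copy a) = h≢ a
mycielskiLabel-≢ f≢ h≢ c≢ apex = c≢

record MycielskiExtension (H : Graph) (f h : Fin (order H) → ℕ) (c : ℕ) : Set where
  field
    orig≢copy      : ∀ a b → f a ≢ h b
    orig-copy-gap  : ∀ a b → Adjacent H a b → 2 ≤ ∣ f a - h b ∣
    copy-distinct  : ∀ a b → h a ≡ h b → a ≡ b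
    copy-apex-gap  : ∀ b → 2 ≤ ∣ h b - c ∣
    orig≢apex      : ∀ a → f a ≢ c

mycielskiLabel-isL21 : (H : Graph) {f h : Fin (order H) → ℕ} {c : ℕ} → IsL21 H f →
  MycielskiExtension H f h c → IsL21 (M H) (mycielskiLabel f h c ∘ cls)
mycielskiLabel-isL21 H {f} {h} {c} (f-adj , f-dist2) E =
    (λ x y → adjacent-gap (cls x) (cls y))
  , λ { x y (x≢y , xy , w , xw , wy) → dist2-distinct (cls x) (cls y) (x≢y ∘ cls-injective) xy (cls w) xw wy }
  where
  open MycielskiExtension E
  g = mycielskiLabel f h c

  adjacent-gap : ∀ κ ν → adjK H κ ν ≡ true → 2 ≤ ∣ g κ - g ν ∣
  adjacent-gap (orig a) (orig b) ab = f-adj a b ab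
  adjacent-gap (orig a) (copy b) ab = orig-copy-gap a b ab
  adjacent-gap (copy a) (orig b) ab rewrite ∣-∣-comm (h a) (f b) = orig-copy-gap b a (trans (Graph.sym H b a) ab)
  adjacent-gap (copy a) apex _ = copy-apex-gap a
  adjacent-gap apex (copy b) _ rewrite ∣-∣-comm c (h b) = copy-apex-gap b

  dist2-distinct : ∀ κ ν → κ ≢ ν → adjK H κ ν ≡ false → ∀ ω → adjK H κ ω ≡ true → adjK H ω ν ≡ true → g κ ≢ g ν
  dist2-distinct (orig a) (orig b) a≢b ab (orig w) aw wb = f-dist2 a b (a≢b ∘ cong orig , ab , w , aw , wb)
  dist2-distinct (orig a) (orig b) a≢b ab (copy w) aw wb = f-dist2 a b (a≢b ∘ cong orig , ab , w , aw , wb)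
  dist2-distinct (orig a) (copy b) _ _ _ _ _ = orig≢copy a b
  dist2-distinct (orig a) apex _ _ _ _ _ = orig≢apex a
  dist2-distinct (copy a) (orig b) _ _ _ _ _ = orig≢copy b a ∘ sym
  dist2-distinct (copy a) (copy b) a≢b _ _ _ _ = a≢b ∘ cong copy ∘ copy-distinct a b
  dist2-distinct apex (orig b) _ _ _ _ _ = orig≢apex b ∘ sym
  dist2-distinct apex apex a≢b _ _ _ _ = ⊥-elim (a≢b refl)

+2≤⇒2≤∣-∣ : ∀ {x y} → x + 2 ≤ y → 2 ≤ ∣ x - y ∣
+2≤⇒2≤∣-∣ {zero} p = p
+2≤⇒2≤∣-∣ {suc x} {suc y} (s≤s p) = +2≤⇒2≤∣-∣ {x} p

+2≤⇒2≤∣-∣ʳ : ∀ {x y} → x + 2 ≤ y → 2 ≤ ∣ y - x ∣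
+2≤⇒2≤∣-∣ʳ {x} {y} p rewrite ∣-∣-comm y x = +2≤⇒2≤∣-∣ p

2≤∣-∣⇒+2≤ : ∀ {x y} → x ≤ y → 2 ≤ ∣ x - y ∣ → x + 2 ≤ y
2≤∣-∣⇒+2≤ {zero} _ p = p
2≤∣-∣⇒+2≤ {suc x} {suc y} (s≤s x≤y) p = s≤s (2≤∣-∣⇒+2≤ x≤y p)

L21Within : Graph → ℕ → Set
L21Within H m = Σ[ f ∈ (Fin (order H) → ℕ) ] IsL21 H f × (∀ v → f v ≤ m)

λ-minimal : {H : Graph} → IsLambda H k → L21Within H m → k ≤ m
λ-minimal (_ , minimal) (f , isL21 , f≤m) = minimal f _ isL21 f≤m

record SpareL21 (H : Graph) (K : ℕ) : Set where
  field
    label        : Fin (order H) → ℕ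
    isL21        : IsL21 H label
    label≤K      : ∀ v → label v ≤ K
    spare        : ℕ
    spare≤K      : spare ≤ K
    label≢spare  : ∀ v → label v ≢ spare

record TightSpareL21 (H : Graph) (K : ℕ) : Set where
  field
    spareL21   : SpareL21 H K
    spare<K    : SpareL21.spare spareL21 < K
    top        : Fin (order H)
    label-top  : SpareL21.label spareL21 top ≡ K

spareL21-above : {H : Graph} → L21Within H m → SpareL21 H (suc m)
spareL21-above {m = m} (f , isL21 , f≤m) = record
  { label = f ; isL21 = isL21 ; label≤K = m≤n⇒m≤1+n ∘ f≤m
  ; spare = suc m ; spare≤K = ≤-refl ; label≢spare = λ v → <⇒≢ (s≤s (f≤m v)) }

m+2≤2+[m+n] : ∀ m n → m + 2 ≤ suc (suc (m + n))
m+2≤2+[m+n] m n = ≤-trans (≤-reflexive (+-comm m 2)) (s≤s (s≤s (m≤m+n m n)))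

last : Fin n → Σ[ a ∈ Fin n ] suc (toℕ a) ≡ n
last {suc n} _ = fromℕ n , cong suc (Finₚ.toℕ-fromℕ n)

M-tightSpareL21 : (H : Graph) {K : ℕ} → SpareL21 H K → Fin (order H) → TightSpareL21 (M H) (suc (K + order H))
M-tightSpareL21 H {K} S z = record
  { spareL21 = record
    { label = mycielskiLabel f h spare ∘ cls
    ; isL21 = mycielskiLabel-isL21 H isL21 extension
    ; label≤K = mycielskiLabel-≤ (λ a → ≤-trans (label≤K a) K≤K′) h≤K′ (≤-trans spare≤K K≤K′) ∘ cls
    ; spare = suc K
    ; spare≤K = s≤s (m≤m+n K (order H))
    ; label≢spare = mycielskiLabel-≢ (λ a → <⇒≢ (s≤s (label≤K a))) (λ a → >⇒≢ (s≤s (s≤s (m≤m+n K (toℕ a)))))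
                                     (<⇒≢ (s≤s spare≤K)) ∘ cls
    }
  ; spare<K = s≤s (m<m+n K (m<n⇒0<n (Finₚ.toℕ<n z)))
  ; top = toVertex (copy (proj₁ (last z)))
  ; label-top = trans (cong (mycielskiLabel f h spare) (cls-toVertex (copy (proj₁ (last z)))))
                      (cong suc (trans (sym (+-suc K _)) (cong (K +_) (proj₂ (last z)))))
  }
  where
  open SpareL21 S renaming (label to f)

  K≤K′ : K ≤ suc (K + order H)
  K≤K′ = m≤n⇒m≤1+n (m≤m+n K (order H))

  h : Fin (order H) → ℕ
  h a = suc (suc (K + toℕ a))

  h≤K′ : ∀ a → h a ≤ suc (K + order H)
  h≤K′ a = s≤s (+-monoʳ-< K (Finₚ.toℕ<n a))

  K+2≤h : ∀ a → K + 2 ≤ h a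
  K+2≤h a = m+2≤2+[m+n] K (toℕ a)

  extension : MycielskiExtension H f h spare
  extension = record
    { orig≢copy = λ a b → <⇒≢ (≤-trans (s≤s (label≤K a)) (m≤n⇒m≤1+n (s≤s (m≤m+n K (toℕ b)))))
    ; orig-copy-gap = λ a b _ → +2≤⇒2≤∣-∣ (≤-trans (+-monoˡ-≤ 2 (label≤K a)) (K+2≤h b))
    ; copy-distinct = λ a b → Finₚ.toℕ-injective ∘ +-cancelˡ-≡ K _ _ ∘ suc-injective ∘ suc-injective
    ; copy-apex-gap = λ b → +2≤⇒2≤∣-∣ʳ (≤-trans (+-monoˡ-≤ 2 spare≤K) (K+2≤h b))
    ; orig≢apex = label≢spare
    }

transpose-sends : (i j : Fin n) → transpose i j ⟨$⟩ʳ i ≡ j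
transpose-sends i j rewrite dec-true (i Finₚ.≟ i) refl = refl

permutation-injective : (σ : Permutation′ n) {a b : Fin n} → σ ⟨$⟩ʳ a ≡ σ ⟨$⟩ʳ b → a ≡ b
permutation-injective σ eq = trans (sym (inverseˡ σ)) (trans (cong (σ ⟨$⟩ˡ_) eq) (inverseˡ σ))

sendToZero : (i : Fin n) → Σ[ σ ∈ Permutation′ n ] toℕ (σ ⟨$⟩ʳ i) ≡ 0
sendToZero {suc n} i = transpose i fzero , cong toℕ (transpose-sends i fzero)

-- The copy of the top vertex can take the label K + 1: the neighbours of the top vertex carry
-- labels at most K − 2, and the spare label, which goes to the apex, is below K.
M-L21Within : (H : Graph) {K : ℕ} → TightSpareL21 H K → L21Within (M H) (K + order H)
M-L21Within H {K} T =
    mycielskiLabel f h spare ∘ cls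
  , mycielskiLabel-isL21 H isL21 extension
  , mycielskiLabel-≤ (λ a → ≤-trans (label≤K a) (m≤m+n K _)) h≤K+n (≤-trans spare≤K (m≤m+n K _)) ∘ cls
  where
  open TightSpareL21 T
  open SpareL21 spareL21 renaming (label to f)
  σ : Permutation′ (order H)
  σ = proj₁ (sendToZero top)

  h : Fin (order H) → ℕ
  h a = suc (K + toℕ (σ ⟨$⟩ʳ a))

  h≤K+n : ∀ a → h a ≤ K + order H
  h≤K+n a = +-monoʳ-< K (Finₚ.toℕ<n (σ ⟨$⟩ʳ a))

  orig-copy-gap : ∀ a b → Adjacent H a b → 2 ≤ ∣ f a - h b ∣
  orig-copy-gap a b ab with toℕ (σ ⟨$⟩ʳ b) in σb
  ... | zero = +2≤⇒2≤∣-∣ (≤-trans f[a]+2≤K (m≤n⇒m≤1+n (m≤m+n K 0)))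
    where
    b≡top : b ≡ top
    b≡top = permutation-injective σ (Finₚ.toℕ-injective (trans σb (sym (proj₂ (sendToZero top)))))
    f[a]+2≤K : f a + 2 ≤ K
    f[a]+2≤K = 2≤∣-∣⇒+2≤ (label≤K a) (subst (λ y → 2 ≤ ∣ f a - y ∣) label-top
                 (proj₁ isL21 a top (subst (Adjacent H a) b≡top ab)))
  ... | suc j = +2≤⇒2≤∣-∣ (≤-trans (+-monoˡ-≤ 2 (label≤K a))
                  (≤-trans (m+2≤2+[m+n] K j) (≤-reflexive (cong suc (sym (+-suc K j))))))

  extension : MycielskiExtension H f h spare
  extension = record
    { orig≢copy = λ a b → <⇒≢ (s≤s (≤-trans (label≤K a) (m≤m+n K _)))
    ; orig-copy-gap = orig-copy-gap
    ; copy-distinct = λ a b → permutation-injective σ ∘ Finₚ.toℕ-injective ∘ +-cancelˡ-≡ K _ _ ∘ suc-injective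
    ; copy-apex-gap = λ b → +2≤⇒2≤∣-∣ʳ (≤-trans (≤-reflexive (+-comm spare 2)) (s≤s (≤-trans spare<K (m≤m+n K _))))
    ; orig≢apex = label≢spare
    }

doubling-step : ∀ r {x s} → suc x ≡ 2 ^ r * s → suc (suc (x + x)) ≡ 2 ^ suc r * s
doubling-step r {x} {s} eq = begin
  suc (suc (x + x))          ≡⟨ cong suc (sym (+-suc x x)) ⟩
  suc x + suc x              ≡⟨ cong₂ _+_ eq eq ⟩
  2 ^ r * s + 2 ^ r * s      ≡⟨ double-* (2 ^ r) s ⟩
  2 ^ suc r * s              ∎
  where
  open ≡-Reasoning
  double-* : ∀ a b → a * b + a * b ≡ (2 * a) * b
  double-* = solve-∀

suc-order-M^ : ∀ t G → suc (order (M^ t G)) ≡ 2 ^ t * suc (order G)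
suc-order-M^ zero G = sym (*-identityˡ _)
suc-order-M^ (suc t) G = doubling-step t (suc-order-M^ t G)

module _ (G : Graph) (z : Fin (order G)) {l : ℕ} (L : L21Within G l) where

  tightSpareL21-M^ : ∀ r → Σ[ K ∈ ℕ ] TightSpareL21 (M^ (suc r) G) K × K + order G ≡ l + suc (order (M^ (suc r) G))
  tightSpareL21-M^ zero = _ , M-tightSpareL21 G (spareL21-above L) z , first-step l (order G)
    where
    first-step : ∀ l n → suc (suc l + n) + n ≡ l + suc (suc (n + n))
    first-step = solve-∀
  tightSpareL21-M^ (suc r) with tightSpareL21-M^ r
  ... | K , T , K+n≡ = _ , M-tightSpareL21 _ spareL21 top , (begin
      suc (K + o) + order G     ≡⟨ swap-+ K o (order G) ⟩
      suc (K + order G + o)     ≡⟨ cong (λ y → suc (y + o)) K+n≡ ⟩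
      suc (l + suc o + o)       ≡⟨ regroup l o ⟩
      l + suc (suc (o + o))     ∎)
    where
    open TightSpareL21 T
    open ≡-Reasoning
    o = order (M^ (suc r) G)
    swap-+ : ∀ K o n → suc (K + o) + n ≡ suc (K + n + o)
    swap-+ = solve-∀
    regroup : ∀ l o → suc (l + suc o + o) ≡ l + suc (suc (o + o))
    regroup = solve-∀

  λ-M^-upper : ∀ r {l′} → IsLambda (M^ (2 + r) G) l′ → l′ + order G ≤ l + order (M^ (2 + r) G)
  λ-M^-upper r {l′} Λ with tightSpareL21-M^ r
  ... | K , T , K+n≡ = begin
      l′ + order G          ≤⟨ +-monoˡ-≤ (order G) (λ-minimal {H = M^ (2 + r) G} Λ (M-L21Within (M^ (suc r) G) T)) ⟩
      K + o + order G       ≡⟨ swap-+ K o (order G) ⟩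
      K + order G + o       ≡⟨ cong (_+ o) K+n≡ ⟩
      l + suc o + o         ≡⟨ regroup l o ⟩
      l + suc (o + o)       ∎
    where
    open ≤-Reasoning
    o = order (M^ (suc r) G)
    swap-+ : ∀ K o n → K + o + n ≡ K + n + o
    swap-+ = solve-∀
    regroup : ∀ l o → l + suc o + o ≡ l + suc (o + o)
    regroup = solve-∀

≤-closed-form : ∀ {l′ l n o} p → 0 < p → suc o ≡ p * suc n → l′ + n ≤ l + o → l′ ≤ (p ∸ 1) * (n + 1) + l
≤-closed-form {l′} {l} {n} {o} (suc q) _ eq le = +-cancelʳ-≤ n l′ _ (begin
    l′ + n                   ≤⟨ le ⟩
    l + o                    ≡⟨ cong (l +_) (suc-injective eq) ⟩
    l + (n + q * suc n)      ≡⟨ regroup l n q ⟩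
    q * (n + 1) + l + n      ∎)
  where
  open ≤-Reasoning
  regroup : ∀ l n q → l + (n + q * suc n) ≡ q * (n + 1) + l + n
  regroup = solve-∀

-- Cliques of the square graph

Within2 : (G : Graph) → Fin (order G) → Fin (order G) → Set
Within2 G x y = Adjacent G x y ⊎ Dist2 G x y

adjacent-sym : (G : Graph) {x y : Fin (order G)} → Adjacent G x y → Adjacent G y x
adjacent-sym G {x} {y} xy = trans (Graph.sym G y x) xy

within2-via : (G : Graph) {x y : Fin (order G)} (w : Fin (order G)) → x ≢ y → Adjacent G x w → Adjacent G w y →
  Within2 G x y
within2-via G {x} {y} w x≢y xw wy with adj G x y
... | true = inj₁ refl
... | false = inj₂ (x≢y , refl , w , xw , wy)

within2-sym : (G : Graph) {x y : Fin (order G)} → Within2 G x y → Within2 G y x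
within2-sym G (inj₁ xy) = inj₁ (adjacent-sym G xy)
within2-sym G {x} {y} (inj₂ (x≢y , xy , w , xw , wy)) =
  inj₂ (x≢y ∘ sym , trans (Graph.sym G y x) xy , w , adjacent-sym G wy , adjacent-sym G xw)

within2⇒≢ : (G : Graph) {x y : Fin (order G)} → Within2 G x y → x ≢ y
within2⇒≢ G (inj₁ xy) refl with () ← trans (sym (Graph.irrefl G _)) xy
within2⇒≢ G (inj₂ (x≢y , _)) = x≢y

L21-within2-distinct : (G : Graph) {f : Fin (order G) → ℕ} {x y : Fin (order G)} →
  IsL21 G f → Within2 G x y → f x ≢ f y
L21-within2-distinct G {f} (f-adj , _) (inj₁ xy) fx≡fy
  with () ← subst (2 ≤_) (m≡n⇒∣m-n∣≡0 fx≡fy) (f-adj _ _ xy)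
L21-within2-distinct G (_ , f-dist2) (inj₂ d) = f-dist2 _ _ d

-- Non-isolation is what lets it double in
-- M G: the apex reaches v through the copy of a neighbour of v, and v reaches its own copy through
-- a neighbour.
record SquareClique (G : Graph) (k : ℕ) : Set where
  field
    vertex     : Fin k → Fin (order G)
    within2    : ∀ {i j} → i ≢ j → Within2 G (vertex i) (vertex j)
    neighbour  : ∀ i → Σ[ w ∈ Fin (order G) ] Adjacent G (vertex i) w

squareClique-size : {H : Graph} → SquareClique H k → L21Within H m → k ≤ suc m
squareClique-size {k} {m} {H} C (f , isL21 , f≤m) = k≤1+m
  where
  open SquareClique C
  label : Fin k → Fin (suc m)
  label i = fromℕ< (s≤s (f≤m (vertex i)))

  k≤1+m : k ≤ suc m
  k≤1+m with k ≤? suc m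
  ... | yes k≤1+m = k≤1+m
  ... | no k≰1+m with Finₚ.pigeonhole (≰⇒> k≰1+m) label
  ...   | i , j , i<j , eq = ⊥-elim (L21-within2-distinct H isL21 (within2 (Finₚ.<⇒≢ i<j))
                                      (Finₚ.fromℕ<-injective _ _ _ _ eq))

squareClique-λ : {H : Graph} → SquareClique H k → IsLambda H l → suc k ∸ 2 ≤ l
squareClique-λ C (L , _) = ∸-monoˡ-≤ 2 (s≤s (squareClique-size C L))

module _ (H : Graph) where

  adjacentᴹ : {κ ν : Kind (order H)} → adjK H κ ν ≡ true → Adjacent (M H) (toVertex κ) (toVertex ν)
  adjacentᴹ {κ} {ν} κν rewrite cls-toVertex κ | cls-toVertex ν = κν

  within2-viaᴹ : {κ ω ν : Kind (order H)} → κ ≢ ν → adjK H κ ω ≡ true → adjK H ω ν ≡ true →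
    Within2 (M H) (toVertex κ) (toVertex ν)
  within2-viaᴹ {κ} {ω} {ν} κ≢ν κω ων =
    within2-via (M H) (toVertex ω) (κ≢ν ∘ toVertex-injective) (adjacentᴹ {κ} {ω} κω) (adjacentᴹ {ω} {ν} ων)

  within2-orig-orig : {x y : Fin (order H)} → Within2 H x y → Within2 (M H) (toVertex (orig x)) (toVertex (orig y))
  within2-orig-orig {x} {y} (inj₁ xy) = inj₁ (adjacentᴹ {orig x} {orig y} xy)
  within2-orig-orig {x} {y} (inj₂ (x≢y , _ , w , xw , wy)) = within2-viaᴹ {orig x} {orig w} {orig y} (x≢y ∘ orig-injective) xw wy

  within2-orig-copy : {x y : Fin (order H)} → Within2 H x y → Within2 (M H) (toVertex (orig x)) (toVertex (copy y))
  within2-orig-copy {x} {y} (inj₁ xy) = inj₁ (adjacentᴹ {orig x} {copy y} xy)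
  within2-orig-copy {x} {y} (inj₂ (_ , _ , w , xw , wy)) = within2-viaᴹ {orig x} {orig w} {copy y} (λ ()) xw wy

  within2-orig-own-copy : {x w : Fin (order H)} → Adjacent H x w → Within2 (M H) (toVertex (orig x)) (toVertex (copy x))
  within2-orig-own-copy {x} {w} xw = within2-viaᴹ {orig x} {orig w} {copy x} (λ ()) xw (adjacent-sym H xw)

  within2-orig-apex : {x w : Fin (order H)} → Adjacent H x w → Within2 (M H) (toVertex (orig x)) (toVertex {order H} apex)
  within2-orig-apex {x} {w} xw = within2-viaᴹ {orig x} {copy w} {apex} (λ ()) xw refl

  within2-copy-copy : {x y : Fin (order H)} → x ≢ y → Within2 (M H) (toVertex (copy x)) (toVertex (copy y))
  within2-copy-copy {x} {y} x≢y = within2-viaᴹ {copy x} {apex} {copy y} (x≢y ∘ copy-injective) refl refl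

  within2-copy-apex : {x : Fin (order H)} → Within2 (M H) (toVertex (copy x)) (toVertex {order H} apex)
  within2-copy-apex {x} = inj₁ (adjacentᴹ {copy x} {apex} refl)

mapKind : (Fin k → Fin n) → Kind k → Kind n
mapKind e (orig a) = orig (e a)
mapKind e (copy a) = copy (e a)
mapKind e apex = apex

M-squareClique : (H : Graph) → Fin (order H) → SquareClique H k → SquareClique (M H) (suc (k + k))
M-squareClique {k} H z C = record
  { vertex = toVertex ∘ mapKind vertex ∘ cls
  ; within2 = λ {i} {j} i≢j → within2ᴹ (cls i) (cls j) (i≢j ∘ cls-injective)
  ; neighbour = neighbourᴹ ∘ cls
  }
  where
  open SquareClique C
  vertexᴹ : Kind k → Fin (order (M H))
  vertexᴹ = toVertex ∘ mapKind vertex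

  within2ᴹ : ∀ p q → p ≢ q → Within2 (M H) (vertexᴹ p) (vertexᴹ q)
  within2ᴹ (orig a) (orig b) a≢b = within2-orig-orig H (within2 (a≢b ∘ cong orig))
  within2ᴹ (orig a) (copy b) _ with a Finₚ.≟ b
  ... | yes refl = within2-orig-own-copy H (proj₂ (neighbour a))
  ... | no a≢b = within2-orig-copy H (within2 a≢b)
  within2ᴹ (orig a) apex _ = within2-orig-apex H (proj₂ (neighbour a))
  within2ᴹ (copy a) (orig b) a≢b = within2-sym (M H) (within2ᴹ (orig b) (copy a) (a≢b ∘ sym))
  within2ᴹ (copy a) (copy b) a≢b = within2-copy-copy H (within2⇒≢ H (within2 (a≢b ∘ cong copy)))
  within2ᴹ (copy a) apex _ = within2-copy-apex H
  within2ᴹ apex (orig b) _ = within2-sym (M H) (within2-orig-apex H (proj₂ (neighbour b)))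
  within2ᴹ apex (copy b) _ = within2-sym (M H) (within2-copy-apex H)
  within2ᴹ apex apex a≢a = ⊥-elim (a≢a refl)

  neighbourᴹ : ∀ p → Σ[ w ∈ Fin (order (M H)) ] Adjacent (M H) (vertexᴹ p) w
  neighbourᴹ (orig a) = toVertex (orig (proj₁ (neighbour a))) , adjacentᴹ H {orig (vertex a)} {orig _} (proj₂ (neighbour a))
  neighbourᴹ (copy a) = toVertex {order H} apex , adjacentᴹ H {copy (vertex a)} {apex} refl
  neighbourᴹ apex = toVertex (copy z) , adjacentᴹ H {apex} {copy z} refl

M^-vertex : {G : Graph} → Fin (order G) → ∀ r → Fin (order (M^ r G))
M^-vertex z zero = z
M^-vertex z (suc r) = fzero

M^-squareClique : (H : Graph) → Fin (order H) → SquareClique H k → ∀ r →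
  Σ[ k′ ∈ ℕ ] SquareClique (M^ r H) k′ × suc k′ ≡ 2 ^ r * suc k
M^-squareClique {k} H z C zero = k , C , sym (*-identityˡ _)
M^-squareClique H z C (suc r) with M^-squareClique H z C r
... | k′ , C′ , eq = suc (k′ + k′) , M-squareClique (M^ r H) (M^-vertex z r) C′ , doubling-step r eq

M^-M : ∀ r G → M^ r (M G) ≡ M^ (suc r) G
M^-M zero G = refl
M^-M (suc r) G = cong M (M^-M r G)

apexOrCopy : Fin (suc n) → Kind n
apexOrCopy fzero = apex
apexOrCopy (fsuc i) = copy i

apex-copies-squareClique : (G : Graph) → Fin (order G) → SquareClique (M G) (suc (order G))
apex-copies-squareClique G z = record
  { vertex = toVertex ∘ apexOrCopy
  ; within2 = within2ᴹ _ _
  ; neighbour = neighbourᴹ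
  }
  where
  within2ᴹ : ∀ i j → i ≢ j → Within2 (M G) (toVertex (apexOrCopy i)) (toVertex (apexOrCopy j))
  within2ᴹ fzero fzero 0≢0 = ⊥-elim (0≢0 refl)
  within2ᴹ fzero (fsuc j) _ = within2-sym (M G) (within2-copy-apex G)
  within2ᴹ (fsuc i) fzero _ = within2-copy-apex G
  within2ᴹ (fsuc i) (fsuc j) i≢j = within2-copy-copy G (i≢j ∘ cong fsuc)

  neighbourᴹ : ∀ i → Σ[ w ∈ Fin (order (M G)) ] Adjacent (M G) (toVertex (apexOrCopy i)) w
  neighbourᴹ fzero = toVertex (copy z) , adjacentᴹ G {apex} {copy z} refl
  neighbourᴹ (fsuc i) = toVertex {order G} apex , adjacentᴹ G {copy i} {apex} refl

Unique-lookup-injective : {A : Set} {xs : List A} → Unique xs → ∀ i j → lookup xs i ≡ lookup xs j → i ≡ j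
Unique-lookup-injective (_ ∷ _) fzero fzero _ = refl
Unique-lookup-injective (x∉xs ∷ _) fzero (fsuc j) eq = ⊥-elim (All.lookup x∉xs (∈-lookup j) eq)
Unique-lookup-injective (x∉xs ∷ _) (fsuc i) fzero eq = ⊥-elim (All.lookup x∉xs (∈-lookup i) (sym eq))
Unique-lookup-injective (_ ∷ xs!) (fsuc i) (fsuc j) eq = cong fsuc (Unique-lookup-injective xs! i j eq)

star-squareClique : (G : Graph) (v : Fin (order G)) → Fin (degree G v) → SquareClique G (suc (degree G v))
star-squareClique G v w₀ = record
  { vertex = star
  ; within2 = within2ˢ _ _
  ; neighbour = λ { fzero → neighbour w₀ , v-neighbour w₀ ; (fsuc i) → v , adjacent-sym G (v-neighbour i) }
  }
  where
  isNeighbour = λ w → T? (adj G v w)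
  neighbour : Fin (degree G v) → Fin (order G)
  neighbour = lookup (filter isNeighbour (allFin (order G)))

  v-neighbour : ∀ i → Adjacent G v (neighbour i)
  v-neighbour i = Equivalence.to T-≡ (proj₂ (∈-filter⁻ isNeighbour {xs = allFin (order G)} (∈-lookup i)))

  neighbour-injective : ∀ i j → neighbour i ≡ neighbour j → i ≡ j
  neighbour-injective = Unique-lookup-injective (Uniqueₚ.filter⁺ isNeighbour (Uniqueₚ.allFin⁺ (order G)))

  star : Fin (suc (degree G v)) → Fin (order G)
  star fzero = v
  star (fsuc i) = neighbour i

  within2ˢ : ∀ i j → i ≢ j → Within2 G (star i) (star j)
  within2ˢ fzero fzero 0≢0 = ⊥-elim (0≢0 refl)
  within2ˢ fzero (fsuc j) _ = inj₁ (v-neighbour j)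
  within2ˢ (fsuc i) fzero _ = inj₁ (adjacent-sym G (v-neighbour i))
  within2ˢ (fsuc i) (fsuc j) i≢j =
    within2-via G v (i≢j ∘ cong fsuc ∘ neighbour-injective i j) (adjacent-sym G (v-neighbour i)) (v-neighbour j)

foldr-⊔-attained : {A : Set} (f : A → ℕ) (xs : List A) {d : ℕ} → foldr _⊔_ 0 (map f xs) ≡ suc d → Σ[ x ∈ A ] f x ≡ suc d
foldr-⊔-attained f (x ∷ xs) eq with ⊔-sel (f x) (foldr _⊔_ 0 (map f xs))
... | inj₁ max≡fx = x , trans (sym max≡fx) eq
... | inj₂ max≡rest = foldr-⊔-attained f xs (trans (sym max≡rest) eq)

λ-M^-lower-order : (G : Graph) → Fin (order G) → ∀ r {l′} → IsLambda (M^ (2 + r) G) l′ →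
  2 ^ suc r * (order G + 2) ∸ 2 ≤ l′
λ-M^-lower-order G z r {l′} Λ with M^-squareClique (M G) fzero (apex-copies-squareClique G z) (suc r)
... | k , C , 1+k≡ = subst (λ x → x ∸ 2 ≤ l′) (trans 1+k≡ (cong (2 ^ suc r *_) (+-comm 2 (order G))))
                       (squareClique-λ (subst (λ H → SquareClique H k) (M^-M (suc r) G) C) Λ)

λ-M^-lower-degree : (G : Graph) → 2 ≤ order G → ∀ r {l′} → IsLambda (M^ (2 + r) G) l′ →
  2 ^ suc r * (2 * (maxDegree G + 2)) ∸ 2 ≤ l′
λ-M^-lower-degree G 2≤n r {l′} Λ with maxDegree G in Δ≡
-- For Δ = 0 the star cannot double, but then the order term dominates since n ≥ 2.
... | zero = ≤-trans (∸-monoˡ-≤ 2 (*-monoʳ-≤ (2 ^ suc r) (+-monoˡ-≤ 2 2≤n)))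
                     (λ-M^-lower-order G (fromℕ< (≤-trans (s≤s z≤n) 2≤n)) r Λ)
... | suc d with foldr-⊔-attained (degree G) (allFin (order G)) Δ≡
...   | v , deg≡ with M^-squareClique G v (star-squareClique G v (subst Fin (sym deg≡) fzero)) (2 + r)
...     | k , C , 1+k≡ = subst (λ x → x ∸ 2 ≤ l′) size≡ (squareClique-λ C Λ)
  where
  regroup : ∀ x d → (2 * x) * suc (suc (suc d)) ≡ x * (2 * (suc d + 2))
  regroup = solve-∀
  size≡ : suc k ≡ 2 ^ suc r * (2 * (suc d + 2))
  size≡ = trans 1+k≡ (trans (cong (λ e → 2 ^ (2 + r) * suc (suc e)) deg≡) (regroup (2 ^ suc r) d))

λ-M^-lower : (G : Graph) → 2 ≤ order G → ∀ r {l′} → IsLambda (M^ (2 + r) G) l′ →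
  2 ^ suc r * ((order G + 2) ⊔ (2 * (maxDegree G + 2))) ∸ 2 ≤ l′
λ-M^-lower G 2≤n r Λ
  rewrite *-distribˡ-⊔ (2 ^ suc r) (order G + 2) (2 * (maxDegree G + 2))
        | ∸-distribʳ-⊔ 2 (2 ^ suc r * (order G + 2)) (2 ^ suc r * (2 * (maxDegree G + 2)))
  = ⊔-lub (λ-M^-lower-order G (fromℕ< (≤-trans (s≤s z≤n) 2≤n)) r Λ) (λ-M^-lower-degree G 2≤n r Λ)

theorem4p1 : (G : Graph) → 2 ≤ order G → (t : ℕ) → 2 ≤ t →
    (l l′ : ℕ) → IsLambda G l → IsLambda (M^ t G) l′ →
    (2 ^ (t ∸ 1)) * ((order G + 2) ⊔ (2 * (maxDegree G + 2))) ∸ 2 ≤ l′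
    × l′ ≤ (2 ^ t ∸ 1) * (order G + 1) + l
theorem4p1 G 2≤n (suc (suc r)) (s≤s (s≤s z≤n)) l l′ (L , _) Λ′ =
    λ-M^-lower G 2≤n r Λ′
  , ≤-closed-form (2 ^ (2 + r)) (m^n>0 2 (2 + r)) (suc-order-M^ (2 + r) G) (λ-M^-upper G z L r Λ′)
  where
  z : Fin (order G)
  z = fromℕ< (≤-trans (s≤s z≤n) 2≤n)
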